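{- For any finite sequence of channel actions $\sigma$ and any $x\in\Sigma^*$, $$\mathrm{Pre}[\sigma^*](\uparrow x)=\bigcup_{i=0}^{L(\sigma,x)}\uparrow\mathrm{pr}[\sigma^i](x).$$
   Context: Channel actions over a finite alphabet $\Sigma$ are $!w$ and $?w$ ($w\in\Sigma^*$). $\sqsubseteq$ is the scattered subword ordering; $\uparrow x=\{y : x\sqsubseteq y\}$. Lossy semantics: $x\xrightarrow{!w}y$ iff $y\sqsubseteq xw$, $x\xrightarrow{?w}y$ iff $wy\sqsubseteq x$, extended to sequences by composition. $\mathrm{Pre}[\sigma](\uparrow x)=\{z : \exists x'\in\uparrow x,\ z\xrightarrow{\sigma}x'\}$ and $\mathrm{Pre}[\sigma^*](\uparrow x)=\bigcup_{k\in\mathbb{N}}\mathrm{Pre}[\sigma^k](\uparrow x)$, with $\sigma^0$ the empty sequence. $\mathrm{pr}[\sigma](x)$ is the unique word $y$ with $\mathrm{Pre}[\sigma](\uparrow x)=\uparrow y$. The iteration number $L(\sigma,x)$ is the smallest integer $L$ such that there exists $\ell\le L$ with $\mathrm{pr}[\sigma^\ell](x)\sqsubseteq\mathrm{pr}[\sigma^{L+1}](x)$ (it exists by Higman's lemma). -}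

module Defs where

open import Data.Nat using (ℕ; zero; suc; _≤_)
open import Data.Fin using (Fin)
open import Data.List using (List; []; _∷_; _++_)
open import Data.Product using (Σ; ∃; _×_; _,_)
open import Relation.Binary.PropositionalEquality using (_≡_)
import Data.List.Relation.Binary.Sublist.Propositional as Sub

Word : ℕ → Set
Word n = List (Fin n)

_⊑_ : ∀ {n} → Word n → Word n → Set
u ⊑ v = Sub._⊆_ u v

data Action (n : ℕ) : Set where
  send : Word n → Action n
  recv : Word n → Action n

Step : ∀ {n} → Action n → Word n → Word n → Set
Step (send w) x y = y ⊑ (x ++ w)
Step (recv w) x y = (w ++ y) ⊑ x

Run : ∀ {n} → List (Action n) → Word n → Word n → Set
Run []      x y = x ≡ y
Run (a ∷ σ) x y = ∃ λ z → Step a x z × Run σ z y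

pow : ∀ {n} → List (Action n) → ℕ → List (Action n)
pow σ zero    = []
pow σ (suc k) = σ ++ pow σ k

WordSet : ℕ → Set₁
WordSet n = Word n → Set

up : ∀ {n} → Word n → WordSet n
up x y = x ⊑ y

Pre : ∀ {n} → List (Action n) → WordSet n → WordSet n
Pre σ S z = ∃ λ x' → S x' × Run σ z x'

PreStar : ∀ {n} → List (Action n) → WordSet n → WordSet n
PreStar σ S z = ∃ λ k → Pre (pow σ k) S z

_≐_ : ∀ {n} → WordSet n → WordSet n → Set
S ≐ T = ∀ z → (S z → T z) × (T z → S z)

-- y is pr[τ](x): the (unique) word with Pre[τ](↑x) = ↑y.
IsPr : ∀ {n} → List (Action n) → Word n → Word n → Set
IsPr τ x y = Pre τ (up x) ≐ up y

-- Given p with p i = pr[σ^i](x) for all i, "L satisfies the defining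
-- property": ∃ ℓ ≤ L with p ℓ ⊑ p (L+1).
IterProp : ∀ {n} → (ℕ → Word n) → ℕ → Set
IterProp p L = ∃ λ ℓ → ℓ ≤ L × (p ℓ ⊑ p (suc L))

IsIterNum : ∀ {n} → (ℕ → Word n) → ℕ → Set
IsIterNum p L = IterProp p L × (∀ L' → IterProp p L' → L ≤ L')

UnionUpTo : ∀ {n} → (ℕ → Word n) → ℕ → WordSet n
UnionUpTo p L z = ∃ λ i → i ≤ L × (p i ⊑ z)

-- Pre distributes over concatenation of action sequences, so
-- ↑pr[σ^(m+a)](x) = Pre[σ^m](↑pr[σ^a](x)); as Pre is monotone, pr[σ^a](x) ⊑ pr[σ^b](x)
-- implies pr[σ^(m+a)](x) ⊑ pr[σ^(m+b)](x).  Applied to the witness pr[σ^ℓ](x) ⊑ pr[σ^(L+1)](x),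
-- this lets every index k > L be replaced by the smaller index k − (L + 1 − ℓ), so every
-- ↑pr[σ^k](x) is contained in one of ↑pr[σ^i](x) with i ≤ L.
module Submission where

open import Defs
open import Data.Nat using (ℕ; zero; suc; _+_; _∸_; _<_; _≤?_; s≤s)
open import Data.Nat.Induction using (<-rec)
open import Data.Nat.Properties using (m∸n+n≡m; +-monoʳ-<; ≰⇒>)
open import Data.List using (List; []; _∷_; _++_)
open import Data.List.Properties using (++-assoc)
open import Data.Product using (∃; _×_; _,_; proj₁; proj₂)
open import Relation.Binary.PropositionalEquality using (_≡_; refl; sym; subst)
open import Relation.Nullary using (yes; no)
open import Relation.Unary using (_⊆_)
open import Data.List.Relation.Binary.Sublist.Propositional using (⊆-refl; ⊆-trans)

private
  variable
    n : ℕ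
    σ τ : List (Action n)
    S T : WordSet n

Run-++⁻ : ∀ (σ : List (Action n)) {x y} →
          Run (σ ++ τ) x y → ∃ λ z → Run σ x z × Run τ z y
Run-++⁻ []      r             = _ , refl , r
Run-++⁻ (a ∷ σ) (z , s , r) with Run-++⁻ σ r
... | w , r₁ , r₂ = w , (z , s , r₁) , r₂

Run-++⁺ : ∀ (σ : List (Action n)) {x z y} → Run σ x z → Run τ z y → Run (σ ++ τ) x y
Run-++⁺ []      refl            r₂ = r₂
Run-++⁺ (a ∷ σ) (w , s , r₁)   r₂ = w , s , Run-++⁺ σ r₁ r₂

Pre-++⁻ : ∀ (σ : List (Action n)) → Pre (σ ++ τ) S ⊆ Pre σ (Pre τ S)
Pre-++⁻ σ (y , y∈S , r) with Run-++⁻ σ r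
... | z , r₁ , r₂ = z , (y , y∈S , r₂) , r₁

Pre-++⁺ : ∀ (σ : List (Action n)) → Pre σ (Pre τ S) ⊆ Pre (σ ++ τ) S
Pre-++⁺ σ (z , (y , y∈S , r₂) , r₁) = y , y∈S , Run-++⁺ σ r₁ r₂

Pre-mono : S ⊆ T → Pre σ S ⊆ Pre σ T
Pre-mono S⊆T (y , y∈S , r) = y , S⊆T y∈S , r

pow-+ : ∀ (σ : List (Action n)) m a → pow σ (m + a) ≡ pow σ m ++ pow σ a
pow-+ σ zero    a = refl
pow-+ σ (suc m) a rewrite pow-+ σ m a = sym (++-assoc σ (pow σ m) (pow σ a))

Pre-pow-+⁻ : ∀ (σ : List (Action n)) m a → Pre (pow σ (m + a)) S ⊆ Pre (pow σ m) (Pre (pow σ a) S)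
Pre-pow-+⁻ σ m a rewrite pow-+ σ m a = Pre-++⁻ (pow σ m)

Pre-pow-+⁺ : ∀ (σ : List (Action n)) m a → Pre (pow σ m) (Pre (pow σ a) S) ⊆ Pre (pow σ (m + a)) S
Pre-pow-+⁺ σ m a rewrite pow-+ σ m a = Pre-++⁺ (pow σ m)

ShiftMonotone : (ℕ → Word n) → Set
ShiftMonotone p = ∀ m {a b} → p a ⊑ p b → p (m + a) ⊑ p (m + b)

pr-shiftMonotone : ∀ (σ : List (Action n)) x (pr : ℕ → Word n) →
                   (∀ i → IsPr (pow σ i) x (pr i)) → ShiftMonotone pr
pr-shiftMonotone σ x pr isPr m {a} {b} pra⊑prb =
  sound (m + a) (Pre-pow-+⁺ σ m a (Pre-mono Pre-b⊆Pre-a (Pre-pow-+⁻ σ m b (complete (m + b) ⊆-refl))))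
  where
  sound : ∀ i → Pre (pow σ i) (up x) ⊆ up (pr i)
  sound i {z} = proj₁ (isPr i z)
  complete : ∀ i → up (pr i) ⊆ Pre (pow σ i) (up x)
  complete i {z} = proj₂ (isPr i z)
  Pre-b⊆Pre-a : Pre (pow σ b) (up x) ⊆ Pre (pow σ a) (up x)
  Pre-b⊆Pre-a z∈Pre = complete a (⊆-trans pra⊑prb (sound b z∈Pre))

UnionUpTo-upward : ∀ {p : ℕ → Word n} {L y z} → UnionUpTo p L y → y ⊑ z → UnionUpTo p L z
UnionUpTo-upward (i , i≤L , pi⊑y) y⊑z = i , i≤L , ⊆-trans pi⊑y y⊑z

dominated-upTo : ∀ {p : ℕ → Word n} {L} → ShiftMonotone p → IterProp p L →
                 ∀ k → UnionUpTo p L (p k)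
dominated-upTo {p = p} {L} shift (ℓ , ℓ≤L , pℓ⊑pL+1) = <-rec (λ k → UnionUpTo p L (p k)) step
  where
  step : ∀ k → (∀ {j} → j < k → UnionUpTo p L (p j)) → UnionUpTo p L (p k)
  step k rec with k ≤? L
  ... | yes k≤L = k , k≤L , ⊆-refl
  ... | no  k≰L = UnionUpTo-upward (rec smaller) (subst (λ t → p (m + ℓ) ⊑ p t) m+L+1≡k (shift m pℓ⊑pL+1))
    where
    m = k ∸ suc L
    m+L+1≡k : m + suc L ≡ k
    m+L+1≡k = m∸n+n≡m (≰⇒> k≰L)
    smaller : m + ℓ < k
    smaller = subst (m + ℓ <_) m+L+1≡k (+-monoʳ-< m (s≤s ℓ≤L))

lemma9 : ∀ {n} (σ : List (Action n)) (x : Word n)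
    (pr : ℕ → Word n) → (∀ i → IsPr (pow σ i) x (pr i))
    → (L : ℕ) → IsIterNum pr L
    → PreStar σ (up x) ≐ UnionUpTo pr L
lemma9 σ x pr isPr L (iter , _) z = to , from
  where
  to : PreStar σ (up x) z → UnionUpTo pr L z
  to (k , z∈Pre) =
    UnionUpTo-upward (dominated-upTo (pr-shiftMonotone σ x pr isPr) iter k) (proj₁ (isPr k z) z∈Pre)
  from : UnionUpTo pr L z → PreStar σ (up x) z
  from (i , _ , pri⊑z) = i , proj₂ (isPr i z) pri⊑z
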